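{- Let $G$ be a connected graph with vertex set $V$ and edge set $E$. Identify the vertex sets of the subdivision $S(G)$ and of the triangulation $T(G)$ with $V\cup V'$, where $V'$ is a set of new vertices in bijection with $E$, the new vertex associated with the edge $kl\in E$ being adjacent to $k$ and $l$ in both graphs. Let $\Omega^S_{ij}$ and $\Omega^T_{ij}$ denote resistance distances in $S(G)$ and $T(G)$ respectively. Then: (1) for $i,j\in V$, $\Omega^T_{ij}=\frac{1}{3}\Omega^S_{ij}$; (2) for $i\in V'$ and $j\in V$, $\Omega^T_{ij}=\frac{1}{3}\Omega^S_{ij}+\frac{1}{3}$; (3) for distinct $i,j\in V'$, $\Omega^T_{ij}=\frac{1}{3}\Omega^S_{ij}+\frac{2}{3}$.
   Context: All graphs are finite, simple and connected. For a connected graph $H$, the resistance distance between vertices $i,j$ is the effective resistance between $i$ and $j$ in the electrical network obtained from $H$ by replacing each edge with a unit resistor. The subdivision $S(G)$ is obtained from $G$ by replacing every edge $uv$ by a path $u w v$ with $w$ a new vertex (so $uv$ is no longer an edge). The triangulation $T(G)$ is obtained from $G$ by changing each edge $uv$ into a triangle $uwv$ with $w$ a new vertex associated with $uv$ (so $uv$ remains an edge). -}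

module Defs where

open import Data.Nat using (ℕ)
open import Data.Bool using (Bool; true; false; _∧_; _∨_; if_then_else_)
open import Data.Fin using (Fin)
open import Data.Fin.Properties using (_≟_)
open import Data.List using (List; map; _++_; allFin; foldr)
open import Data.Bool.ListAction using (any)
open import Data.Product using (Σ; _×_; _,_; proj₁; proj₂)
open import Data.Sum using (_⊎_; inj₁; inj₂)
open import Data.Rational using (ℚ; 0ℚ; 1ℚ; _+_; _-_; _*_)
open import Relation.Nullary using (¬_)
open import Relation.Nullary.Decidable using (⌊_⌋)
open import Relation.Binary.Definitions using (DecidableEquality)
open import Relation.Binary.PropositionalEquality using (_≡_)

-- Generic finite graphs given by a Bool adjacency on a vertex type V
-- together with an enumeration of V (a list of all vertices, no repeats).

data Reach {V : Set} (A : V → V → Bool) : V → V → Set where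
  here : ∀ {u} → Reach A u u
  step : ∀ {u v w} → A u v ≡ true → Reach A v w → Reach A u w

Connected : {V : Set} → (V → V → Bool) → Set
Connected {V} A = (u v : V) → Reach A u v

sumℚ : {V : Set} → List V → (V → ℚ) → ℚ
sumℚ vs f = foldr (λ v acc → f v + acc) 0ℚ vs

laplacian : {V : Set} → List V → (V → V → Bool) → (V → ℚ) → V → ℚ
laplacian vs A x u = sumℚ vs (λ w → if A u w then x u - x w else 0ℚ)

δ : {V : Set} → DecidableEquality V → V → V → ℚ
δ eq i u = if ⌊ eq i u ⌋ then 1ℚ else 0ℚ

-- r is the resistance distance between i and j: r is the potential
-- difference x_i - x_j for a potential x produced by injecting a unit
-- current at i and extracting it at j, i.e. L x = e_i - e_j.
-- (For connected graphs such x exists and x_i - x_j is uniquely determined.)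
IsResistance : {V : Set} → DecidableEquality V → List V →
               (V → V → Bool) → V → V → ℚ → Set
IsResistance {V} eq vs A i j r =
  Σ (V → ℚ) λ x →
    ((u : V) → laplacian vs A x u ≡ δ eq i u - δ eq j u) × (r ≡ x i - x j)

-- The base graph G: vertices Fin n, edges given by an enumeration
-- ends : Fin m → Fin n × Fin n (edge k joins proj₁ (ends k) and proj₂ (ends k)).

adjG : {n m : ℕ} → (Fin m → Fin n × Fin n) → Fin n → Fin n → Bool
adjG {n} {m} ends u v =
  any (λ k → (⌊ u ≟ proj₁ (ends k) ⌋ ∧ ⌊ v ≟ proj₂ (ends k) ⌋)
           ∨ (⌊ u ≟ proj₂ (ends k) ⌋ ∧ ⌊ v ≟ proj₁ (ends k) ⌋))
      (allFin m)

SimpleEdges : {n m : ℕ} → (Fin m → Fin n × Fin n) → Set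
SimpleEdges {n} {m} ends =
  ((k : Fin m) → ¬ (proj₁ (ends k) ≡ proj₂ (ends k))) ×
  ((k l : Fin m) →
     ((proj₁ (ends k) ≡ proj₁ (ends l)) × (proj₂ (ends k) ≡ proj₂ (ends l))) ⊎
     ((proj₁ (ends k) ≡ proj₂ (ends l)) × (proj₂ (ends k) ≡ proj₁ (ends l))) →
     k ≡ l)

incident : {n m : ℕ} → (Fin m → Fin n × Fin n) → Fin n → Fin m → Bool
incident ends u k = ⌊ u ≟ proj₁ (ends k) ⌋ ∨ ⌊ u ≟ proj₂ (ends k) ⌋

-- Vertex set V ∪ V' of S(G) and T(G): inj₁ = original vertex, inj₂ k = new
-- vertex associated with edge k.
VV : ℕ → ℕ → Set
VV n m = Fin n ⊎ Fin m

enumVV : (n m : ℕ) → List (VV n m)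
enumVV n m = map inj₁ (allFin n) ++ map inj₂ (allFin m)

eqVV : {n m : ℕ} → DecidableEquality (VV n m)
eqVV = Data.Sum.Properties.≡-dec _≟_ _≟_
  where import Data.Sum.Properties

adjS : {n m : ℕ} → (Fin m → Fin n × Fin n) → VV n m → VV n m → Bool
adjS ends (inj₁ u) (inj₁ v) = false
adjS ends (inj₁ u) (inj₂ k) = incident ends u k
adjS ends (inj₂ k) (inj₁ u) = incident ends u k
adjS ends (inj₂ k) (inj₂ l) = false

adjT : {n m : ℕ} → (Fin m → Fin n × Fin n) → VV n m → VV n m → Bool
adjT ends (inj₁ u) (inj₁ v) = adjG ends u v
adjT ends (inj₁ u) (inj₂ k) = incident ends u k
adjT ends (inj₂ k) (inj₁ u) = incident ends u k
adjT ends (inj₂ k) (inj₂ l) = false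

ΩS : {n m : ℕ} → (Fin m → Fin n × Fin n) → VV n m → VV n m → ℚ → Set
ΩS {n} {m} ends = IsResistance eqVV (enumVV n m) (adjS ends)

ΩT : {n m : ℕ} → (Fin m → Fin n × Fin n) → VV n m → VV n m → ℚ → Set
ΩT {n} {m} ends = IsResistance eqVV (enumVV n m) (adjT ends)

-- Let x be a potential on S(G).  Put y = x/3 on the old vertices and, on the new
-- vertex k of an edge pq, y_k = x_k − (x_p + x_q)/3.  Then L_T y = L_S x: at k both
-- Laplacians give 2y_k − y_p − y_q = 2x_k − x_p − x_q, and at an old vertex u the extra
-- T-edge uv of each incident edge k = uv is compensated by the shift of y_k.  Since
-- Laplacians are symmetric, two potentials driven by the same current e_i − e_j have the
-- same difference between i and j, so Ω^T_ij = y_i − y_j.  Finally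
-- y = (x + L_S x restricted to V')/3 with L_S x = e_i − e_j, which adds 1/3 for each
-- of i, j lying in V'.

module Submission where

open import Defs
open import Data.Nat using (ℕ; zero; suc)
open import Data.Integer using (+_)
open import Data.Fin using (Fin; zero; suc)
open import Data.Fin.Properties using (_≟_; suc-injective; 0≢1+n)
open import Data.Bool using (Bool; true; false; _∧_; _∨_; if_then_else_)
open import Data.Bool.Properties using (∨-comm; ∧-comm; ∨-identityʳ; T-≡; T-∧; T-∨)
open import Function.Bundles using (module Equivalence)
open import Data.List using (List; []; _∷_; map; _++_; allFin; tabulate; length; lookup)
open import Data.Bool.ListAction using (or)
open import Data.List.Properties using (map-tabulate; map-cong)
open import Data.Product as Product using (_×_; _,_; proj₁; proj₂)
open import Data.Sum as Sum using (_⊎_; inj₁; inj₂)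
open import Data.Sum.Properties using (inj₂-injective)
open import Data.Rational using (ℚ; 0ℚ; 1ℚ; _+_; _-_; _*_; _/_)
import Data.Rational.Properties as ℚ
open import Data.Rational.Solver using (module +-*-Solver)
open +-*-Solver
open import Algebra.Bundles using (Ring)
open import Algebra.Properties.Semiring.Sum (Ring.semiring ℚ.+-*-ring)
  using (sum; sum-syntax; sum-cong-≗; sum-replicate-zero; ∑-distrib-+; ∑-comm; *-distribˡ-sum; *-distribʳ-sum)
open import Data.Empty using (⊥-elim)
open import Function using (_∘_; id)
open import Relation.Nullary using (¬_; yes; no)
open import Relation.Binary.Definitions using (DecidableEquality)
open import Relation.Nullary.Decidable using (⌊_⌋; ⌊⌋-map′; toWitness)
open import Relation.Binary.PropositionalEquality
  using (_≡_; _≢_; refl; sym; trans; cong; cong₂; module ≡-Reasoning)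

-- Finite sums over ℚ

when : Bool → ℚ → ℚ
when b q = if b then q else 0ℚ

when-+ : ∀ b p q → when b p + when b q ≡ when b (p + q)
when-+ true  p q = refl
when-+ false p q = refl

∑-distrib-- : ∀ {n} (f g : Fin n → ℚ) → ∑[ i < n ] (f i - g i) ≡ ∑[ i < n ] f i - ∑[ i < n ] g i
∑-distrib-- {zero}  f g = refl
∑-distrib-- {suc n} f g = trans (cong (_+_ (f zero - g zero)) (∑-distrib-- (f ∘ suc) (g ∘ suc)))
  (solve 4 (λ a b c d → (a :- b) :+ (c :- d) := (a :+ c) :- (b :+ d)) refl (f zero) (g zero) (sum (f ∘ suc)) (sum (g ∘ suc)))

≟-sym : ∀ {n} (a c : Fin n) → ⌊ a ≟ c ⌋ ≡ ⌊ c ≟ a ⌋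
≟-sym a c with a ≟ c | c ≟ a
... | yes _   | yes _   = refl
... | yes a≡c | no  c≢a = ⊥-elim (c≢a (sym a≡c))
... | no  a≢c | yes c≡a = ⊥-elim (a≢c (sym c≡a))
... | no  _   | no  _   = refl

∑-δ : ∀ {n} (c : Fin n) (h : Fin n → ℚ) → ∑[ a < n ] when ⌊ a ≟ c ⌋ (h a) ≡ h c
∑-δ {suc n} zero    h = trans (cong (_+_ (h zero)) (sum-replicate-zero n)) (ℚ.+-identityʳ (h zero))
∑-δ {suc n} (suc c) h = trans (ℚ.+-identityˡ _)
  (trans (sum-cong-≗ (λ a → cong (λ b → when b (h (suc a))) (⌊⌋-map′ _ _ (a ≟ c)))) (∑-δ c (h ∘ suc)))

∑-δ′ : ∀ {n} (c : Fin n) (h : Fin n → ℚ) → ∑[ a < n ] when ⌊ c ≟ a ⌋ (h a) ≡ h c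
∑-δ′ {n} c h = trans (sum-cong-≗ {n} (λ a → cong (λ b → when b (h a)) (≟-sym c a))) (∑-δ c h)

∑-either : ∀ {n} {p q : Fin n} → p ≢ q → (h : Fin n → ℚ) →
           ∑[ v < n ] when (⌊ v ≟ p ⌋ ∨ ⌊ v ≟ q ⌋) (h v) ≡ h p + h q
∑-either {n} {p} {q} p≢q h =
  trans (sum-cong-≗ {n} split) (trans (∑-distrib-+ (λ v → when ⌊ v ≟ p ⌋ (h v)) (λ v → when ⌊ v ≟ q ⌋ (h v)))
         (cong₂ _+_ (∑-δ p h) (∑-δ q h)))
  where
  split : ∀ v → when (⌊ v ≟ p ⌋ ∨ ⌊ v ≟ q ⌋) (h v) ≡ when ⌊ v ≟ p ⌋ (h v) + when ⌊ v ≟ q ⌋ (h v)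
  split v with v ≟ p | v ≟ q
  ... | yes v≡p | yes v≡q = ⊥-elim (p≢q (trans (sym v≡p) v≡q))
  ... | yes _   | no  _   = sym (ℚ.+-identityʳ (h v))
  ... | no  _   | yes _   = sym (ℚ.+-identityˡ (h v))
  ... | no  _   | no  _   = refl

when-or-tabulate : ∀ {m} (h : Fin m → Bool) → (∀ {k l} → h k ≡ true → h l ≡ true → k ≡ l) →
                   ∀ c → when (or (tabulate h)) c ≡ ∑[ k < m ] when (h k) c
when-or-tabulate {zero}  h uniq c = refl
when-or-tabulate {suc m} h uniq c with h zero in h0
... | true  = sym (trans (cong (_+_ c) (trans (sum-cong-≗ {m} rest-vanishes) (sum-replicate-zero m))) (ℚ.+-identityʳ c))
  where
  rest-vanishes : ∀ k → when (h (suc k)) c ≡ 0ℚ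
  rest-vanishes k with h (suc k) in hk
  ... | true  = ⊥-elim (0≢1+n (uniq h0 hk))
  ... | false = refl
... | false = trans (when-or-tabulate (h ∘ suc) (λ hk hl → suc-injective (uniq hk hl)) c)
                    (sym (ℚ.+-identityˡ _))

module _ {A : Set} where

  sumℚ-lookup : (xs : List A) (f : A → ℚ) → sumℚ xs f ≡ ∑[ i < length xs ] f (lookup xs i)
  sumℚ-lookup []       f = refl
  sumℚ-lookup (x ∷ xs) f = cong (_+_ (f x)) (sumℚ-lookup xs f)

  sumℚ-tabulate : ∀ {n} (g : Fin n → A) (f : A → ℚ) → sumℚ (tabulate g) f ≡ ∑[ i < n ] f (g i)
  sumℚ-tabulate {zero}  g f = refl
  sumℚ-tabulate {suc n} g f = cong (_+_ (f (g zero))) (sumℚ-tabulate (g ∘ suc) f)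

  sumℚ-++ : (xs ys : List A) (f : A → ℚ) → sumℚ (xs ++ ys) f ≡ sumℚ xs f + sumℚ ys f
  sumℚ-++ []       ys f = sym (ℚ.+-identityˡ _)
  sumℚ-++ (x ∷ xs) ys f = trans (cong (_+_ (f x)) (sumℚ-++ xs ys f)) (sym (ℚ.+-assoc (f x) _ _))

  sumℚ-cong : (xs : List A) {f g : A → ℚ} → (∀ x → f x ≡ g x) → sumℚ xs f ≡ sumℚ xs g
  sumℚ-cong xs {f} {g} f≗g = trans (sumℚ-lookup xs f)
    (trans (sum-cong-≗ {length xs} (f≗g ∘ lookup xs)) (sym (sumℚ-lookup xs g)))

  sumℚ-distrib-- : (xs : List A) (f g : A → ℚ) → sumℚ xs (λ x → f x - g x) ≡ sumℚ xs f - sumℚ xs g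
  sumℚ-distrib-- xs f g = trans (sumℚ-lookup xs (λ x → f x - g x))
    (trans (∑-distrib-- (f ∘ lookup xs) (g ∘ lookup xs))
           (sym (cong₂ _-_ (sumℚ-lookup xs f) (sumℚ-lookup xs g))))

sumℚ-enumVV : ∀ {n m} (f : VV n m → ℚ) →
              sumℚ (enumVV n m) f ≡ ∑[ a < n ] f (inj₁ a) + ∑[ k < m ] f (inj₂ k)
sumℚ-enumVV {n} {m} f = trans (sumℚ-++ (map inj₁ (allFin n)) _ f) (cong₂ _+_ (block inj₁) (block inj₂))
  where
  block : ∀ {N} (ι : Fin N → VV n m) → sumℚ (map ι (allFin N)) f ≡ ∑[ a < N ] f (ι a)
  block ι = trans (cong (λ xs → sumℚ xs f) (map-tabulate id ι)) (sumℚ-tabulate ι f)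

-- Reciprocity of graph Laplacians

when-distrib-*ʳ : ∀ b p q r → when b (p - q) * r ≡ when b (p * r) - when b (q * r)
when-distrib-*ʳ true  p q r = solve 3 (λ p q r → (p :- q) :* r := p :* r :- q :* r) refl p q r
when-distrib-*ʳ false p q r = ℚ.*-zeroˡ r

when-distrib-*ˡ : ∀ b p q r → p * when b (q - r) ≡ when b (p * q) - when b (p * r)
when-distrib-*ˡ true  p q r = solve 3 (λ p q r → p :* (q :- r) := p :* q :- p :* r) refl p q r
when-distrib-*ˡ false p q r = ℚ.*-zeroʳ p

module _ {N : ℕ} (a : Fin N → Fin N → Bool) (a-sym : ∀ i j → a i j ≡ a j i) where

  ∑-reciprocity : (x y : Fin N → ℚ) →
    ∑[ i < N ] ((∑[ j < N ] when (a i j) (x i - x j)) * y i) ≡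
    ∑[ i < N ] (x i * ∑[ j < N ] when (a i j) (y i - y j))
  ∑-reciprocity x y = begin
      ∑[ i < N ] ((∑[ j < N ] when (a i j) (x i - x j)) * y i)
    ≡⟨ sum-cong-≗ {N} expandˡ ⟩
      ∑[ i < N ] (∑[ j < N ] P i j - ∑[ j < N ] Q i j)
    ≡⟨ ∑-distrib-- (λ i → ∑[ j < N ] P i j) (λ i → ∑[ j < N ] Q i j) ⟩
      ∑∑ P - ∑∑ Q
    ≡⟨ cong (∑∑ P -_) ∑∑Q≡∑∑R ⟩
      ∑∑ P - ∑∑ R
    ≡⟨ sym (∑-distrib-- (λ i → ∑[ j < N ] P i j) (λ i → ∑[ j < N ] R i j)) ⟩
      ∑[ i < N ] (∑[ j < N ] P i j - ∑[ j < N ] R i j)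
    ≡⟨ sym (sum-cong-≗ {N} expandʳ) ⟩
      ∑[ i < N ] (x i * ∑[ j < N ] when (a i j) (y i - y j)) ∎
    where
    open ≡-Reasoning
    P Q R : Fin N → Fin N → ℚ
    P i j = when (a i j) (x i * y i)
    Q i j = when (a i j) (x j * y i)
    R i j = when (a i j) (x i * y j)
    ∑∑ : (Fin N → Fin N → ℚ) → ℚ
    ∑∑ F = ∑[ i < N ] ∑[ j < N ] F i j
    expandˡ : ∀ i → (∑[ j < N ] when (a i j) (x i - x j)) * y i ≡ ∑[ j < N ] P i j - ∑[ j < N ] Q i j
    expandˡ i = trans (*-distribʳ-sum (y i) (λ j → when (a i j) (x i - x j)))
      (trans (sum-cong-≗ {N} (λ j → when-distrib-*ʳ (a i j) (x i) (x j) (y i))) (∑-distrib-- (P i) (Q i)))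
    expandʳ : ∀ i → x i * ∑[ j < N ] when (a i j) (y i - y j) ≡ ∑[ j < N ] P i j - ∑[ j < N ] R i j
    expandʳ i = trans (*-distribˡ-sum (x i) (λ j → when (a i j) (y i - y j)))
      (trans (sum-cong-≗ {N} (λ j → when-distrib-*ˡ (a i j) (x i) (y i) (y j))) (∑-distrib-- (P i) (R i)))
    ∑∑Q≡∑∑R : ∑∑ Q ≡ ∑∑ R
    ∑∑Q≡∑∑R = trans (∑-comm Q)
      (sum-cong-≗ {N} (λ i → sum-cong-≗ {N} (λ j → cong (λ b → when b (x i * y j)) (a-sym j i))))

laplacian-reciprocity : ∀ {V : Set} (vs : List V) (A : V → V → Bool) → (∀ u w → A u w ≡ A w u) →
  (x y : V → ℚ) → sumℚ vs (λ u → laplacian vs A x u * y u) ≡ sumℚ vs (λ u → x u * laplacian vs A y u)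
laplacian-reciprocity {V} vs A A-sym x y = begin
    sumℚ vs (λ u → laplacian vs A x u * y u)
  ≡⟨ sumℚ-lookup vs (λ u → laplacian vs A x u * y u) ⟩
    ∑[ i < N ] (laplacian vs A x (g i) * y (g i))
  ≡⟨ sum-cong-≗ {N} (λ i → cong (_* y (g i)) (laplacian-lookup x (g i))) ⟩
    ∑[ i < N ] ((∑[ j < N ] when (A (g i) (g j)) (x (g i) - x (g j))) * y (g i))
  ≡⟨ ∑-reciprocity (λ i j → A (g i) (g j)) (λ i j → A-sym (g i) (g j)) (x ∘ g) (y ∘ g) ⟩
    ∑[ i < N ] (x (g i) * ∑[ j < N ] when (A (g i) (g j)) (y (g i) - y (g j)))
  ≡⟨ sym (sum-cong-≗ {N} (λ i → cong (x (g i) *_) (laplacian-lookup y (g i)))) ⟩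
    ∑[ i < N ] (x (g i) * laplacian vs A y (g i))
  ≡⟨ sym (sumℚ-lookup vs (λ u → x u * laplacian vs A y u)) ⟩
    sumℚ vs (λ u → x u * laplacian vs A y u) ∎
  where
  open ≡-Reasoning
  N : ℕ
  N = length vs
  g : Fin N → V
  g = lookup vs
  laplacian-lookup : ∀ z u → laplacian vs A z u ≡ ∑[ j < N ] when (A u (g j)) (z u - z (g j))
  laplacian-lookup z u = sumℚ-lookup vs (λ w → when (A u w) (z u - z w))

module _ {V : Set} (eq : DecidableEquality V) where

  δ-self : ∀ i → δ eq i i ≡ 1ℚ
  δ-self i with eq i i
  ... | yes _   = refl
  ... | no  i≢i = ⊥-elim (i≢i refl)

  δ-distinct : ∀ {i j} → i ≢ j → δ eq i j ≡ 0ℚ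
  δ-distinct {i} {j} i≢j with eq i j
  ... | yes i≡j = ⊥-elim (i≢j i≡j)
  ... | no  _   = refl

  δ-*ʳ : ∀ i u z → δ eq i u * z ≡ when ⌊ eq i u ⌋ z
  δ-*ʳ i u z with eq i u
  ... | yes _ = ℚ.*-identityˡ z
  ... | no  _ = ℚ.*-zeroˡ z

δ-sum : ∀ {n m} (i : VV n m) (z : VV n m → ℚ) → sumℚ (enumVV n m) (λ u → δ eqVV i u * z u) ≡ z i
δ-sum {n} {m} i z = trans (sumℚ-cong (enumVV n m) (λ u → δ-*ʳ eqVV i u (z u)))
  (trans (sumℚ-enumVV (λ u → when ⌊ eqVV i u ⌋ (z u))) (pick i))
  where
  pick : ∀ i → ∑[ a < n ] when ⌊ eqVV i (inj₁ a) ⌋ (z (inj₁ a)) + ∑[ k < m ] when ⌊ eqVV i (inj₂ k) ⌋ (z (inj₂ k)) ≡ z i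
  pick (inj₁ c) = trans (cong₂ _+_ (trans (sum-cong-≗ {n} (λ a → cong (λ b → when b (z (inj₁ a))) (⌊⌋-map′ _ _ (c ≟ a))))
                                          (∑-δ′ c (z ∘ inj₁)))
                                   (sum-replicate-zero m))
                        (ℚ.+-identityʳ (z (inj₁ c)))
  pick (inj₂ c) = trans (cong₂ _+_ (sum-replicate-zero n)
                                   (trans (sum-cong-≗ {m} (λ k → cong (λ b → when b (z (inj₂ k))) (⌊⌋-map′ _ _ (c ≟ k))))
                                          (∑-δ′ c (z ∘ inj₂))))
                        (ℚ.+-identityˡ (z (inj₂ c)))

dipole-sum : ∀ {n m} (i j : VV n m) (z : VV n m → ℚ) →
             sumℚ (enumVV n m) (λ u → (δ eqVV i u - δ eqVV j u) * z u) ≡ z i - z j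
dipole-sum {n} {m} i j z = trans (sumℚ-cong (enumVV n m) distrib)
  (trans (sumℚ-distrib-- (enumVV n m) (λ u → δ eqVV i u * z u) (λ u → δ eqVV j u * z u)) (cong₂ _-_ (δ-sum i z) (δ-sum j z)))
  where
  distrib : ∀ u → (δ eqVV i u - δ eqVV j u) * z u ≡ δ eqVV i u * z u - δ eqVV j u * z u
  distrib u = solve 3 (λ a b c → (a :- b) :* c := a :* c :- b :* c) refl (δ eqVV i u) (δ eqVV j u) (z u)

potential-difference-unique :
  ∀ {n m} (A : VV n m → VV n m → Bool) → (∀ u w → A u w ≡ A w u) →
  ∀ {i j} (y z : VV n m → ℚ) →
  (∀ u → laplacian (enumVV n m) A y u ≡ δ eqVV i u - δ eqVV j u) →
  (∀ u → laplacian (enumVV n m) A z u ≡ δ eqVV i u - δ eqVV j u) →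
  y i - y j ≡ z i - z j
potential-difference-unique {n} {m} A A-sym {i} {j} y z Ly Lz = begin
    y i - y j
  ≡⟨ sym (dipole-sum i j y) ⟩
    sumℚ vs (λ u → (δ eqVV i u - δ eqVV j u) * y u)
  ≡⟨ sumℚ-cong vs (λ u → cong (_* y u) (sym (Lz u))) ⟩
    sumℚ vs (λ u → laplacian vs A z u * y u)
  ≡⟨ laplacian-reciprocity vs A A-sym z y ⟩
    sumℚ vs (λ u → z u * laplacian vs A y u)
  ≡⟨ sumℚ-cong vs (λ u → trans (cong (z u *_) (Ly u)) (ℚ.*-comm (z u) _)) ⟩
    sumℚ vs (λ u → (δ eqVV i u - δ eqVV j u) * z u)
  ≡⟨ dipole-sum i j z ⟩
    z i - z j ∎
  where
  open ≡-Reasoning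
  vs : List (VV n m)
  vs = enumVV n m

-- Neighbours versus incident edges in a simple graph

joins : ∀ {n} → Fin n × Fin n → Fin n → Fin n → Bool
joins (p , q) u v = (⌊ u ≟ p ⌋ ∧ ⌊ v ≟ q ⌋) ∨ (⌊ u ≟ q ⌋ ∧ ⌊ v ≟ p ⌋)

other-end : ∀ {n} → Fin n × Fin n → Fin n → Fin n
other-end (p , q) u = if ⌊ u ≟ p ⌋ then q else p

joins-sym : ∀ {n} (e : Fin n × Fin n) u v → joins e u v ≡ joins e v u
joins-sym (p , q) u v =
  trans (∨-comm (⌊ u ≟ p ⌋ ∧ ⌊ v ≟ q ⌋) _) (cong₂ _∨_ (∧-comm ⌊ u ≟ q ⌋ _) (∧-comm ⌊ u ≟ p ⌋ _))

joins-sound : ∀ {n} (p q u v : Fin n) → joins (p , q) u v ≡ true → (u ≡ p × v ≡ q) ⊎ (u ≡ q × v ≡ p)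
joins-sound p q u v h =
  Sum.map (Product.map (toWitness {a? = u ≟ p}) (toWitness {a? = v ≟ q}) ∘ Equivalence.to T-∧)
          (Product.map (toWitness {a? = u ≟ q}) (toWitness {a? = v ≟ p}) ∘ Equivalence.to T-∧)
          (Equivalence.to T-∨ (Equivalence.from T-≡ h))

∑-joins : ∀ {n} {p q : Fin n} → p ≢ q → (u : Fin n) (g : Fin n → ℚ) →
          ∑[ v < n ] when (joins (p , q) u v) (g v) ≡ when (⌊ u ≟ p ⌋ ∨ ⌊ u ≟ q ⌋) (g (other-end (p , q) u))
∑-joins {n} {p} {q} p≢q u g with u ≟ p | u ≟ q
... | yes u≡p | yes u≡q = ⊥-elim (p≢q (trans (sym u≡p) u≡q))
... | yes _   | no  _   = trans (sum-cong-≗ {n} (λ v → cong (λ b → when b (g v)) (∨-identityʳ _))) (∑-δ q g)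
... | no  _   | yes _   = ∑-δ p g
... | no  _   | no  _   = sum-replicate-zero n

module _ {n m : ℕ} (ends : Fin m → Fin n × Fin n) where

  adjG-sym : ∀ u v → adjG ends u v ≡ adjG ends v u
  adjG-sym u v = cong or (map-cong (λ k → joins-sym (ends k) u v) (allFin m))

  adjT-sym : ∀ a b → adjT ends a b ≡ adjT ends b a
  adjT-sym (inj₁ u) (inj₁ v) = adjG-sym u v
  adjT-sym (inj₁ u) (inj₂ k) = refl
  adjT-sym (inj₂ k) (inj₁ u) = refl
  adjT-sym (inj₂ k) (inj₂ l) = refl

  edge-unique : SimpleEdges ends → ∀ u v {k l} →
                joins (ends k) u v ≡ true → joins (ends l) u v ≡ true → k ≡ l
  edge-unique (_ , distinct) u v {k} {l} jk jl =
    distinct k l (match (joins-sound _ _ u v jk) (joins-sound _ _ u v jl))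
    where
    match : ∀ {u v p q p′ q′ : Fin n} → (u ≡ p × v ≡ q) ⊎ (u ≡ q × v ≡ p) → (u ≡ p′ × v ≡ q′) ⊎ (u ≡ q′ × v ≡ p′) →
            (p ≡ p′ × q ≡ q′) ⊎ (p ≡ q′ × q ≡ p′)
    match (inj₁ (refl , refl)) (inj₁ (refl , refl)) = inj₁ (refl , refl)
    match (inj₁ (refl , refl)) (inj₂ (refl , refl)) = inj₂ (refl , refl)
    match (inj₂ (refl , refl)) (inj₁ (refl , refl)) = inj₂ (refl , refl)
    match (inj₂ (refl , refl)) (inj₂ (refl , refl)) = inj₁ (refl , refl)

  ∑-adjG : SimpleEdges ends → ∀ u (g : Fin n → ℚ) →
           ∑[ v < n ] when (adjG ends u v) (g v) ≡ ∑[ k < m ] when (incident ends u k) (g (other-end (ends k) u))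
  ∑-adjG simple u g = begin
      ∑[ v < n ] when (adjG ends u v) (g v)
    ≡⟨ sum-cong-≗ {n} (λ v → trans (cong (λ b → when b (g v)) (cong or (map-tabulate id (λ k → joins (ends k) u v))))
                                   (when-or-tabulate (λ k → joins (ends k) u v) (edge-unique simple u v) (g v))) ⟩
      ∑[ v < n ] ∑[ k < m ] when (joins (ends k) u v) (g v)
    ≡⟨ ∑-comm (λ v k → when (joins (ends k) u v) (g v)) ⟩
      ∑[ k < m ] ∑[ v < n ] when (joins (ends k) u v) (g v)
    ≡⟨ sum-cong-≗ {m} (λ k → ∑-joins (proj₁ simple k) u g) ⟩
      ∑[ k < m ] when (incident ends u k) (g (other-end (ends k) u)) ∎
    where open ≡-Reasoning

-- From subdivision to triangulation

⅓ : ℚ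
⅓ = + 1 / 3

on-new : ∀ {n m} → (VV n m → ℚ) → VV n m → ℚ
on-new f (inj₁ _) = 0ℚ
on-new f (inj₂ k) = f (inj₂ k)

is-new : ∀ {n m} → VV n m → ℚ
is-new (inj₁ _) = 0ℚ
is-new (inj₂ _) = 1ℚ

on-new-dipole : ∀ {n m} (i j : VV n m) → i ≢ j →
  let d = λ u → δ eqVV i u - δ eqVV j u in on-new d i - on-new d j ≡ is-new i + is-new j
on-new-dipole (inj₁ a) (inj₁ b) _ = refl
on-new-dipole (inj₁ a) (inj₂ b) _ = cong (λ t → 0ℚ - (0ℚ - t)) (δ-self eqVV (inj₂ b))
on-new-dipole (inj₂ a) (inj₁ b) _ = cong (λ t → t - 0ℚ - 0ℚ) (δ-self eqVV (inj₂ a))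
on-new-dipole (inj₂ a) (inj₂ b) i≢j =
  trans (cong₂ (λ s t → (s - t) - (δ eqVV (inj₂ a) (inj₂ b) - δ eqVV (inj₂ b) (inj₂ b)))
               (δ-self eqVV (inj₂ a)) (δ-distinct eqVV (i≢j ∘ sym)))
        (cong₂ (λ s t → (1ℚ - 0ℚ) - (s - t)) (δ-distinct eqVV i≢j) (δ-self eqVV (inj₂ b)))

module _ {n m : ℕ} (ends : Fin m → Fin n × Fin n) where

  private
    vs : List (VV n m)
    vs = enumVV n m
    LS LT : (VV n m → ℚ) → VV n m → ℚ
    LS = laplacian vs (adjS ends)
    LT = laplacian vs (adjT ends)
    end₁ end₂ : Fin m → VV n m
    end₁ k = inj₁ (proj₁ (ends k))
    end₂ k = inj₁ (proj₂ (ends k))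

  laplacian-at-new-vertex : SimpleEdges ends → (A : VV n m → VV n m → Bool) (k : Fin m) →
    (∀ v → A (inj₂ k) (inj₁ v) ≡ incident ends v k) → (∀ l → A (inj₂ k) (inj₂ l) ≡ false) →
    (z : VV n m → ℚ) → laplacian vs A z (inj₂ k) ≡ (z (inj₂ k) - z (end₁ k)) + (z (inj₂ k) - z (end₂ k))
  laplacian-at-new-vertex simple A k A-old A-new z = begin
      laplacian vs A z (inj₂ k)
    ≡⟨ sumℚ-enumVV (λ w → when (A (inj₂ k) w) (z (inj₂ k) - z w)) ⟩
      ∑[ v < n ] when (A (inj₂ k) (inj₁ v)) (z (inj₂ k) - z (inj₁ v)) + ∑[ l < m ] when (A (inj₂ k) (inj₂ l)) (z (inj₂ k) - z (inj₂ l))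
    ≡⟨ cong₂ _+_ (trans (sum-cong-≗ {n} (λ v → cong (λ b → when b (z (inj₂ k) - z (inj₁ v))) (A-old v)))
                        (∑-either (proj₁ simple k) (λ v → z (inj₂ k) - z (inj₁ v))))
                 (trans (sum-cong-≗ {m} (λ l → cong (λ b → when b (z (inj₂ k) - z (inj₂ l))) (A-new l))) (sum-replicate-zero m)) ⟩
      ((z (inj₂ k) - z (end₁ k)) + (z (inj₂ k) - z (end₂ k))) + 0ℚ
    ≡⟨ ℚ.+-identityʳ _ ⟩
      (z (inj₂ k) - z (end₁ k)) + (z (inj₂ k) - z (end₂ k)) ∎
    where open ≡-Reasoning

  laplacianS-at-old-vertex : (x : VV n m → ℚ) (u : Fin n) →
    LS x (inj₁ u) ≡ ∑[ k < m ] when (incident ends u k) (x (inj₁ u) - x (inj₂ k))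
  laplacianS-at-old-vertex x u = trans (sumℚ-enumVV (λ w → when (adjS ends (inj₁ u) w) (x (inj₁ u) - x w)))
    (trans (cong (_+ ∑[ k < m ] when (incident ends u k) (x (inj₁ u) - x (inj₂ k))) (sum-replicate-zero n)) (ℚ.+-identityˡ _))

  transfer : (VV n m → ℚ) → VV n m → ℚ
  transfer x (inj₁ v) = ⅓ * x (inj₁ v)
  transfer x (inj₂ k) = x (inj₂ k) - ⅓ * (x (end₁ k) + x (end₂ k))

  transfer-at-edge : ∀ x u k →
    when (incident ends u k) ((transfer x (inj₁ u) - transfer x (inj₁ (other-end (ends k) u)))
                              + (transfer x (inj₁ u) - transfer x (inj₂ k)))
      ≡ when (incident ends u k) (x (inj₁ u) - x (inj₂ k))
  transfer-at-edge x u k with u ≟ proj₁ (ends k) | u ≟ proj₂ (ends k)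
  ... | yes refl | _        = solve 3 (λ a b c → (con ⅓ :* a :- con ⅓ :* b) :+ (con ⅓ :* a :- (c :- con ⅓ :* (a :+ b))) := a :- c)
                                refl (x (end₁ k)) (x (end₂ k)) (x (inj₂ k))
  ... | no  _    | yes refl = solve 3 (λ a b c → (con ⅓ :* b :- con ⅓ :* a) :+ (con ⅓ :* b :- (c :- con ⅓ :* (a :+ b))) := b :- c)
                                refl (x (end₁ k)) (x (end₂ k)) (x (inj₂ k))
  ... | no  _    | no  _    = refl

  laplacian-transfer : SimpleEdges ends → ∀ x w → LT (transfer x) w ≡ LS x w
  laplacian-transfer simple x (inj₂ k) = begin
      LT y (inj₂ k)
    ≡⟨ laplacian-at-new-vertex simple (adjT ends) k (λ _ → refl) (λ _ → refl) y ⟩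
      (y (inj₂ k) - y (end₁ k)) + (y (inj₂ k) - y (end₂ k))
    ≡⟨ solve 3 (λ a b c → (c :- con ⅓ :* (a :+ b) :- con ⅓ :* a) :+ (c :- con ⅓ :* (a :+ b) :- con ⅓ :* b)
                          := (c :- a) :+ (c :- b)) refl (x (end₁ k)) (x (end₂ k)) (x (inj₂ k)) ⟩
      (x (inj₂ k) - x (end₁ k)) + (x (inj₂ k) - x (end₂ k))
    ≡⟨ sym (laplacian-at-new-vertex simple (adjS ends) k (λ _ → refl) (λ _ → refl) x) ⟩
      LS x (inj₂ k) ∎
    where
    open ≡-Reasoning
    y : VV n m → ℚ
    y = transfer x
  laplacian-transfer simple x (inj₁ u) = begin
      LT y (inj₁ u)
    ≡⟨ sumℚ-enumVV (λ w → when (adjT ends (inj₁ u) w) (y (inj₁ u) - y w)) ⟩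
      ∑[ v < n ] when (adjG ends u v) (y (inj₁ u) - y (inj₁ v)) + ∑[ k < m ] when (incident ends u k) (y (inj₁ u) - y (inj₂ k))
    ≡⟨ cong (_+ ∑[ k < m ] when (incident ends u k) (y (inj₁ u) - y (inj₂ k)))
            (∑-adjG ends simple u (λ v → y (inj₁ u) - y (inj₁ v))) ⟩
      ∑[ k < m ] when (incident ends u k) (y (inj₁ u) - y (inj₁ (other-end (ends k) u)))
        + ∑[ k < m ] when (incident ends u k) (y (inj₁ u) - y (inj₂ k))
    ≡⟨ sym (∑-distrib-+ (λ k → when (incident ends u k) (y (inj₁ u) - y (inj₁ (other-end (ends k) u))))
                        (λ k → when (incident ends u k) (y (inj₁ u) - y (inj₂ k)))) ⟩
      ∑[ k < m ] (when (incident ends u k) (y (inj₁ u) - y (inj₁ (other-end (ends k) u)))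
                  + when (incident ends u k) (y (inj₁ u) - y (inj₂ k)))
    ≡⟨ sum-cong-≗ {m} (λ k → trans (when-+ (incident ends u k) _ _) (transfer-at-edge x u k)) ⟩
      ∑[ k < m ] when (incident ends u k) (x (inj₁ u) - x (inj₂ k))
    ≡⟨ sym (laplacianS-at-old-vertex x u) ⟩
      LS x (inj₁ u) ∎
    where
    open ≡-Reasoning
    y : VV n m → ℚ
    y = transfer x

  transfer-decomposition : SimpleEdges ends → ∀ x u → transfer x u ≡ ⅓ * (x u + on-new (LS x) u)
  transfer-decomposition simple x (inj₁ v) = sym (cong (⅓ *_) (ℚ.+-identityʳ (x (inj₁ v))))
  transfer-decomposition simple x (inj₂ k) = trans
    (solve 3 (λ a b c → c :- con ⅓ :* (a :+ b) := con ⅓ :* (c :+ ((c :- a) :+ (c :- b))))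
           refl (x (end₁ k)) (x (end₂ k)) (x (inj₂ k)))
    (cong (λ t → ⅓ * (x (inj₂ k) + t)) (sym (laplacian-at-new-vertex simple (adjS ends) k (λ _ → refl) (λ _ → refl) x)))

  ΩT-via-ΩS : SimpleEdges ends → ∀ {i j rS rT} → ΩS ends i j rS → ΩT ends i j rT →
    let d = λ u → δ eqVV i u - δ eqVV j u in rT ≡ ⅓ * rS + ⅓ * (on-new d i - on-new d j)
  ΩT-via-ΩS simple {i} {j} {rS} {rT} (x , LSx≡d , rS≡) (xT , LTxT≡d , rT≡) = begin
      rT
    ≡⟨ rT≡ ⟩
      xT i - xT j
    ≡⟨ potential-difference-unique (adjT ends) (adjT-sym ends) xT (transfer x) LTxT≡d
         (λ u → trans (laplacian-transfer simple x u) (LSx≡d u)) ⟩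
      transfer x i - transfer x j
    ≡⟨ cong₂ _-_ (transfer-decomposition simple x i) (transfer-decomposition simple x j) ⟩
      ⅓ * (x i + on-new (LS x) i) - ⅓ * (x j + on-new (LS x) j)
    ≡⟨ cong₂ (λ a b → ⅓ * (x i + a) - ⅓ * (x j + b)) (on-new-cong i) (on-new-cong j) ⟩
      ⅓ * (x i + on-new d i) - ⅓ * (x j + on-new d j)
    ≡⟨ solve 4 (λ a b c e → con ⅓ :* (a :+ c) :- con ⅓ :* (b :+ e) := con ⅓ :* (a :- b) :+ con ⅓ :* (c :- e))
             refl (x i) (x j) (on-new d i) (on-new d j) ⟩
      ⅓ * (x i - x j) + ⅓ * (on-new d i - on-new d j)
    ≡⟨ cong (λ r → ⅓ * r + ⅓ * (on-new d i - on-new d j)) (sym rS≡) ⟩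
      ⅓ * rS + ⅓ * (on-new d i - on-new d j) ∎
    where
    open ≡-Reasoning
    d : VV n m → ℚ
    d u = δ eqVV i u - δ eqVV j u
    on-new-cong : ∀ u → on-new (LS x) u ≡ on-new d u
    on-new-cong (inj₁ _) = refl
    on-new-cong (inj₂ k) = LSx≡d (inj₂ k)

proposition4p2 : (n m : ℕ) (ends : Fin m → Fin n × Fin n) →
  SimpleEdges ends → Connected (adjG ends) →
  ((i j : Fin n) (rS rT : ℚ) →
    ΩS ends (inj₁ i) (inj₁ j) rS → ΩT ends (inj₁ i) (inj₁ j) rT →
    rT ≡ (+ 1 / 3) * rS) ×
  ((i : Fin m) (j : Fin n) (rS rT : ℚ) →
    ΩS ends (inj₂ i) (inj₁ j) rS → ΩT ends (inj₂ i) (inj₁ j) rT →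
    rT ≡ (+ 1 / 3) * rS + (+ 1 / 3)) ×
  ((i j : Fin m) → ¬ (i ≡ j) → (rS rT : ℚ) →
    ΩS ends (inj₂ i) (inj₂ j) rS → ΩT ends (inj₂ i) (inj₂ j) rT →
    rT ≡ (+ 1 / 3) * rS + (+ 2 / 3))
-- Connectivity only guarantees that the two potentials exist; here both are given.
proposition4p2 n m ends simple _ =
  (λ i j rS rT ΩSij ΩTij → trans (ΩT-via-ΩS ends simple ΩSij ΩTij) (ℚ.+-identityʳ (⅓ * rS))) ,
  (λ i j rS rT ΩSij ΩTij → trans (ΩT-via-ΩS ends simple ΩSij ΩTij)
     (cong (λ t → ⅓ * rS + ⅓ * t) (on-new-dipole (inj₂ i) (inj₁ j) λ ()))) ,
  (λ i j i≢j rS rT ΩSij ΩTij → trans (ΩT-via-ΩS ends simple ΩSij ΩTij)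
     (cong (λ t → ⅓ * rS + ⅓ * t) (on-new-dipole (inj₂ i) (inj₂ j) (i≢j ∘ inj₂-injective))))
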